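{- $\chi((\mathbb{F}_{11})^2) \leq 5$.
   Context: For a field $E$, $\Gamma(E^2)$ denotes the graph whose vertices are the elements of $E^2$, with an edge between $(x_1,x_2)$ and $(x'_1,x'_2)$ whenever $(x'_1-x_1)^2+(x'_2-x_2)^2 = 1$; $\chi(E^2)$ is its chromatic number. $\mathbb{F}_{11}$ is the field with $11$ elements. -}

module Defs where

open import Data.Nat using (ℕ; _+_; _*_; _∸_; _%_)
open import Data.Fin using (Fin; toℕ)
open import Data.Product using (_×_; proj₁; proj₂; Σ)
open import Relation.Binary.PropositionalEquality using (_≡_; _≢_)

-- The field F_11, represented by residues Fin 11 = {0,...,10} with
-- arithmetic modulo 11 (11 is prime, so this is the field with 11 elements).
F₁₁ : Set
F₁₁ = Fin 11

sub₁₁ : F₁₁ → F₁₁ → ℕ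
sub₁₁ x' x = (toℕ x' + 11 ∸ toℕ x) % 11

Vertex : Set
Vertex = F₁₁ × F₁₁

Adj : Vertex → Vertex → Set
Adj p q =
  let d₁ = sub₁₁ (proj₁ q) (proj₁ p)
      d₂ = sub₁₁ (proj₂ q) (proj₂ p)
  in (d₁ * d₁ + d₂ * d₂) % 11 ≡ 1

ProperColouring : ℕ → Set
ProperColouring k = Σ (Vertex → Fin k) λ c → ∀ p q → Adj p q → c p ≢ c q

χ≤ : ℕ → Set
χ≤ k = ProperColouring k

module Submission where

open import Data.Fin using (Fin; #_)
open import Data.Fin.Properties as Fin using (all?)
open import Data.Nat as ℕ using ()
open import Data.Product using (_×_; _,_)
open import Data.Vec using (Vec; []; _∷_; lookup)
open import Level using (Level)
open import Relation.Nullary.Decidable using (Dec; map′; ¬?; _→-dec_; from-yes)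
open import Relation.Binary.PropositionalEquality using (_≢_)

open import Defs

private
  variable
    ℓ : Level
    m n : ℕ.ℕ

all-pairs? : {P : Fin m × Fin n → Set ℓ} → ((xy : Fin m × Fin n) → Dec (P xy)) →
             Dec ((xy : Fin m × Fin n) → P xy)
all-pairs? P? = map′ (λ f (x , y) → f x y) (λ f x y → f (x , y))
                     (all? λ x → all? λ y → P? (x , y))

adjacent? : (p q : Vertex) → Dec (Adj p q)
adjacent? p q = _ ℕ.≟ 1

proper? : ∀ {k} (c : Vertex → Fin k) → Dec (∀ p q → Adj p q → c p ≢ c q)
proper? c = all-pairs? λ p → all-pairs? λ q → adjacent? p q →-dec ¬? (c p Fin.≟ c q)

colourTable : Vec (Vec (Fin 5) 11) 11
colourTable =
  ( # 0 ∷ # 1 ∷ # 3 ∷ # 1 ∷ # 4 ∷ # 0 ∷ # 4 ∷ # 0 ∷ # 3 ∷ # 1 ∷ # 2 ∷ [])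
  ∷ ( # 4 ∷ # 2 ∷ # 1 ∷ # 3 ∷ # 1 ∷ # 3 ∷ # 0 ∷ # 3 ∷ # 1 ∷ # 2 ∷ # 0 ∷ [])
  ∷ ( # 0 ∷ # 1 ∷ # 2 ∷ # 1 ∷ # 3 ∷ # 0 ∷ # 1 ∷ # 2 ∷ # 0 ∷ # 4 ∷ # 3 ∷ [])
  ∷ ( # 3 ∷ # 2 ∷ # 4 ∷ # 2 ∷ # 0 ∷ # 1 ∷ # 2 ∷ # 0 ∷ # 2 ∷ # 0 ∷ # 1 ∷ [])
  ∷ ( # 4 ∷ # 1 ∷ # 0 ∷ # 3 ∷ # 1 ∷ # 3 ∷ # 1 ∷ # 3 ∷ # 0 ∷ # 4 ∷ # 2 ∷ [])
  ∷ ( # 2 ∷ # 0 ∷ # 3 ∷ # 1 ∷ # 2 ∷ # 4 ∷ # 2 ∷ # 0 ∷ # 3 ∷ # 0 ∷ # 4 ∷ [])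
  ∷ ( # 0 ∷ # 3 ∷ # 1 ∷ # 3 ∷ # 4 ∷ # 0 ∷ # 4 ∷ # 3 ∷ # 1 ∷ # 3 ∷ # 2 ∷ [])
  ∷ ( # 4 ∷ # 0 ∷ # 4 ∷ # 2 ∷ # 0 ∷ # 3 ∷ # 0 ∷ # 4 ∷ # 2 ∷ # 4 ∷ # 0 ∷ [])
  ∷ ( # 3 ∷ # 1 ∷ # 2 ∷ # 4 ∷ # 3 ∷ # 1 ∷ # 3 ∷ # 2 ∷ # 4 ∷ # 3 ∷ # 1 ∷ [])
  ∷ ( # 1 ∷ # 2 ∷ # 4 ∷ # 0 ∷ # 4 ∷ # 3 ∷ # 1 ∷ # 4 ∷ # 2 ∷ # 0 ∷ # 2 ∷ [])
  ∷ ( # 2 ∷ # 3 ∷ # 1 ∷ # 3 ∷ # 2 ∷ # 1 ∷ # 2 ∷ # 3 ∷ # 0 ∷ # 4 ∷ # 1 ∷ [])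
  ∷ []

colouring : Vertex → Fin 5
colouring (x , y) = lookup (lookup colourTable x) y

lemma4p5 : χ≤ 5
lemma4p5 = colouring , from-yes (proper? colouring)
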